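{- Let $\sigma,\sigma'$ be configurations of a threshold automaton. If $\tau$ is a steady schedule applicable to $\sigma$ with $\tau(\sigma)=\sigma'$, then $\phi_{\mathit{steady}}(\sigma,\sigma')$ holds with the assignment $(\tau(r))_{r\in\mathcal R}$, where $\tau(r)$ is the number of occurrences of $r$ in $\tau$. Conversely, if $\phi_{\mathit{steady}}(\sigma,\sigma')$ holds with assignment $(y_r)_{r\in\mathcal R}$, then there is a steady schedule $\tau$ applicable to $\sigma$ with $\tau(\sigma)=\sigma'$ and $\tau(r)=y_r$ for all rules $r$.
   Context: A threshold automaton $\mathsf{TA}=(\mathcal L,\mathcal I,\Gamma,\mathcal R)$ over environment $(\Pi,RC,N)$ ($\Pi$ parameters over $\mathbb N_0$, $RC\subseteq\mathbb N_0^\Pi$ integer-linear-definable, $N$ linear) has locations $\mathcal L$, shared variables $\Gamma$ over $\mathbb N_0$, and rules $r=(r.\mathit{from},r.\mathit{to},r.\varphi,r.\vec u)$ with $r.\varphi$ a conjunction of threshold guards (rise: $x\ge a_0+\sum_ia_ip_i$; fall: $x<a_0+\sum_ia_ip_i$; $x\in\Gamma,p_i\in\Pi,a_i\in\mathbb Q$) and $r.\vec u\in\{0,1\}^\Gamma$. A configuration $\sigma=(\sigma.\kappa,\sigma.\vec g,\sigma.\vec p)$ has $\sigma.\kappa\colon\mathcal L\to\mathbb N_0$, $\sigma.\vec g\in\mathbb N_0^\Gamma$, $\sigma.\vec p\in RC$, $\sum_\ell\sigma.\kappa(\ell)=N(\sigma.\vec p)$. $\sigma\models r.\varphi$ means $(\sigma.\vec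 g,\sigma.\vec p)$ satisfies $r.\varphi$. $\sigma$ enables $r$ if $\sigma.\kappa(r.\mathit{from})>0$ and $\sigma\models r.\varphi$; then $r(\sigma)$ keeps parameters, has shared values $\sigma.\vec g+r.\vec u$ and moves one process from $r.\mathit{from}$ to $r.\mathit{to}$. A finite schedule $r_1\dots r_m$ is applicable to $\sigma_0$ if $r_i$ is enabled in $\sigma_{i-1}$ with $\sigma_i=r_i(\sigma_{i-1})$; $\tau(\sigma_0)=\sigma_m$. The context $\omega(\sigma)$ is the set of rise guards of $\mathsf{TA}$ true in $\sigma$ plus fall guards false in $\sigma$; $\tau$ is steady if $\sigma_0,\dots,\sigma_m$ all have the same context. For configurations $\sigma,\sigma'$ and $X=(x_r)_{r\in\mathcal R}\in\mathbb N_0^{\mathcal R}$ consider: (base) $\sigma.\vec p=\sigma'.\vec p$, $\sigma.\vec p\in RC$, $N(\sigma.\vec p)=N(\sigma'.\vec p)$, $\omega(\sigma)=\omega(\sigma')$; (L) for all $\ell$: $\sum_{r.\mathit{to}=\ell}x_r-\sum_{r.\mathit{from}=\ell}x_r=\sigma'.\kappa(\ell)-\sigma.\kappa(\ell)$; ($\Gamma$) for all $z\in\Gamma$: $\sum_rx_r\,r.\vec u[z]=\sigma'.\vec g[z]-\sigma.\vec g[z]$; (R) $x_r>0\Rightarrow\sigma\models r.\varphi$ for all $r$; (appl) for every $r$ with $x_r>0$ there are rules $r_1,\dots,r_s$ with all $x_{r_i}>0$, $\sigma.\kappa(r_1.\mathit{from})>0$, $r_{i-1}.\mathit{to}=r_i.\mathit{from}$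 for $1<i\le s$, $r_s=r$. $\phi_{\mathit{steady}}(\sigma,\sigma')\equiv(\text{base})\wedge\exists X\ge0[(\text{L})\wedge(\Gamma)\wedge(\text{R})\wedge(\text{appl})]$. "$\phi_{\mathit{steady}}(\sigma,\sigma')$ holds with assignment $Y=(y_r)$" means (base) holds and (L),($\Gamma$),(R),(appl) hold for $x_r=y_r$. -}

module Defs where

open import Data.Nat using (ℕ; zero; suc; _∸_; _<_)
import Data.Nat as ℕ
open import Data.Integer as ℤ using (ℤ; +_; _-_)
open import Data.Rational as ℚ using (ℚ)
open import Data.Fin using (Fin; zero; suc; inject₁; fromℕ)
open import Data.Fin.Properties using () renaming (_≟_ to _≟ᶠ_)
open import Data.Vec using (Vec; lookup; updateAt; zipWith; map)
import Data.Vec as Vec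
open import Data.List using (List; []; _∷_; allFin; foldr)
import Data.List as List
open import Data.Nat.ListAction using () renaming (sum to sumℕ)
open import Data.List.Membership.Propositional using (_∈_)
open import Data.List.Relation.Unary.All using (All)
open import Data.Bool using (Bool; true; false)
open import Data.Product using (Σ; _×_; ∃; ∃-syntax)
open import Data.Unit using (⊤)
open import Relation.Nullary using (¬_; yes; no)
open import Relation.Binary.PropositionalEquality using (_≡_)
open import Function.Bundles using (_⇔_)

ΣFin : ∀ {n} → (Fin n → ℕ) → ℕ
ΣFin {n} f = sumℕ (List.map f (allFin n))

toℚ : ℕ → ℚ
toℚ n = + n ℚ./ 1

b2n : Bool → ℕ
b2n true  = 1
b2n false = 0

record LinForm (nΠ : ℕ) : Set where
  constructor linForm
  field
    const : ℤ
    coeff : Vec ℤ nΠ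

evalLin : ∀ {nΠ} → LinForm nΠ → Vec ℕ nΠ → ℤ
evalLin (linForm c a) p = c ℤ.+ Vec.foldr _ ℤ._+_ (+ 0) (zipWith (λ ai pi → ai ℤ.* + pi) a p)

-- Threshold guards:  rise  x ≥ a₀ + Σ aᵢ pᵢ ;  fall  x < a₀ + Σ aᵢ pᵢ  (aᵢ ∈ ℚ)

data GuardKind : Set where
  rise fall : GuardKind

record Guard (nΓ nΠ : ℕ) : Set where
  constructor guard
  field
    kind  : GuardKind
    var   : Fin nΓ
    a₀    : ℚ
    coeff : Vec ℚ nΠ

bound : ∀ {nΓ nΠ} → Guard nΓ nΠ → Vec ℕ nΠ → ℚ
bound (guard _ _ a₀ a) p = a₀ ℚ.+ Vec.foldr _ ℚ._+_ ℚ.0ℚ (zipWith (λ ai pi → ai ℚ.* toℚ pi) a p)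

Holds : ∀ {nΓ nΠ} → Guard nΓ nΠ → Vec ℕ nΓ → Vec ℕ nΠ → Set
Holds gd@(guard rise x _ _) g p = bound gd p ℚ.≤ toℚ (lookup g x)
Holds gd@(guard fall x _ _) g p = toℚ (lookup g x) ℚ.< bound gd p

record Rule (nL nΓ nΠ : ℕ) : Set where
  constructor rule
  field
    from to : Fin nL
    φ       : List (Guard nΓ nΠ)   -- conjunction of threshold guards
    u       : Vec Bool nΓ          -- update vector in {0,1}^Γ

-- RC is given as a finite conjunction of integer linear constraints  c₀ + Σ cᵢ pᵢ ≥ 0,
-- N is an integer linear form in the parameters.
record TA : Set where
  field
    nL nΓ nΠ nR : ℕ
    rules : Fin nR → Rule nL nΓ nΠ
    RCcons : List (LinForm nΠ)
    Nform  : LinForm nΠ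

module _ (A : TA) where
  open TA A
  open Rule

  InRC : Vec ℕ nΠ → Set
  InRC p = All (λ c → + 0 ℤ.≤ evalLin c p) RCcons

  Nval : Vec ℕ nΠ → ℤ
  Nval = evalLin Nform

  record Config : Set where
    constructor config
    field
      κ : Vec ℕ nL
      g : Vec ℕ nΓ
      p : Vec ℕ nΠ
  open Config public

  IsConfig : Config → Set
  IsConfig σ = InRC (p σ) × (+ Vec.sum (κ σ) ≡ Nval (p σ))

  Sat : Config → List (Guard nΓ nΠ) → Set
  Sat σ gs = All (λ gd → Holds gd (g σ) (p σ)) gs

  GuardOfTA : Guard nΓ nΠ → Set
  GuardOfTA gd = ∃[ r ] gd ∈ φ (rules r)

  InContext : Config → Guard nΓ nΠ → Set
  InContext σ gd@(guard rise _ _ _) = GuardOfTA gd × Holds gd (g σ) (p σ)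
  InContext σ gd@(guard fall _ _ _) = GuardOfTA gd × ¬ Holds gd (g σ) (p σ)

  SameContext : Config → Config → Set
  SameContext σ σ' = ∀ gd → InContext σ gd ⇔ InContext σ' gd

  Enabled : Fin nR → Config → Set
  Enabled r σ = 0 < lookup (κ σ) (from (rules r)) × Sat σ (φ (rules r))

  apply : Fin nR → Config → Config
  apply r (config k g p) =
    config (updateAt (updateAt k (from (rules r)) (λ n → n ∸ 1)) (to (rules r)) suc)
           (zipWith ℕ._+_ g (map b2n (u (rules r))))
           p

  -- τ(σ) (as a function on configurations; meaningful when τ is applicable)
  run : Config → List (Fin nR) → Config
  run σ []      = σ
  run σ (r ∷ τ) = run (apply r σ) τ

  configs : Config → List (Fin nR) → List Config
  configs σ []      = σ ∷ []
  configs σ (r ∷ τ) = σ ∷ configs (apply r σ) τ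

  Applicable : Config → List (Fin nR) → Set
  Applicable σ []      = ⊤
  Applicable σ (r ∷ τ) = Enabled r σ × Applicable (apply r σ) τ

  Steady : Config → List (Fin nR) → Set
  Steady σ τ = All (λ σᵢ → SameContext σᵢ σ) (configs σ τ)

  occ : List (Fin nR) → Fin nR → ℕ
  occ []      r = 0
  occ (r' ∷ τ) r with r' ≟ᶠ r
  ... | yes _ = suc (occ τ r)
  ... | no  _ = occ τ r

  Base : Config → Config → Set
  Base σ σ' = (p σ ≡ p σ') × InRC (p σ) × (Nval (p σ) ≡ Nval (p σ')) × SameContext σ σ'

  CondL : Config → Config → (Fin nR → ℕ) → Set
  CondL σ σ' x = ∀ (ℓ : Fin nL) →
    + ΣFin (λ r → Data.Bool.if ⌊ to (rules r) ≟ᶠ ℓ ⌋ then x r else 0)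
      - + ΣFin (λ r → Data.Bool.if ⌊ from (rules r) ≟ᶠ ℓ ⌋ then x r else 0)
    ≡ + lookup (κ σ') ℓ - + lookup (κ σ) ℓ
    where open import Relation.Nullary.Decidable using (⌊_⌋)

  CondΓ : Config → Config → (Fin nR → ℕ) → Set
  CondΓ σ σ' x = ∀ (z : Fin nΓ) →
    + ΣFin (λ r → x r ℕ.* b2n (lookup (u (rules r)) z))
    ≡ + lookup (g σ') z - + lookup (g σ) z

  CondR : Config → (Fin nR → ℕ) → Set
  CondR σ x = ∀ r → 0 < x r → Sat σ (φ (rules r))

  CondAppl : Config → (Fin nR → ℕ) → Set
  CondAppl σ x = ∀ r → 0 < x r →
    ∃[ s ] Σ (Fin (suc s) → Fin nR) λ rs →
        (∀ i → 0 < x (rs i))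
      × (0 < lookup (κ σ) (from (rules (rs zero))))
      × (∀ (i : Fin s) → to (rules (rs (inject₁ i))) ≡ from (rules (rs (suc i))))
      × (rs (fromℕ s) ≡ r)

  PhiSteadyWith : Config → Config → (Fin nR → ℕ) → Set
  PhiSteadyWith σ σ' x =
    Base σ σ' × CondL σ σ' x × CondΓ σ σ' x × CondR σ x × CondAppl σ x

-- Each firing of a rule r moves one process from r.from to r.to and adds r.u to the shared
-- variables, so the occurrence counts of an applicable schedule solve (L) and (Γ); the first
-- firing of r is reached through earlier firings from an initially occupied location, giving
-- (appl), and the guards of fired rules hold in σ because a steady run keeps the context of σ.
-- Conversely, a solution is realised one rule at a time, keeping (L), (Γ) and (appl) for the
-- remaining counts. The only threat to (appl) is moving the last process out of a location ℓ
-- that remaining rules still leave: if no remaining rule enters ℓ, then (L) shows that none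
-- leaves it either; otherwise some path re-enters ℓ, and we fire the last exit from ℓ on that
-- path instead. Shared variables only grow, so every intermediate configuration lies between σ
-- and σ'; since rise guards are monotone and fall guards antitone in the shared variables, it has
-- the same context.

module Submission where

open import Defs
open import Data.Fin using (Fin)
open import Data.List using (List)
open import Data.Nat using (ℕ)
open import Data.Product using (Σ; _×_; ∃-syntax)
open import Relation.Binary.PropositionalEquality using (_≡_)

import Algebra.Properties.CommutativeSemigroup as CommutativeSemigroupProperties
open import Data.Bool using (true; false; if_then_else_)
open import Data.Fin using (zero; suc; inject₁; fromℕ)
open import Data.Fin.Properties using (any?; suc-injective) renaming (_≟_ to _≟ᶠ_)
import Data.Integer as ℤ
open import Data.Integer using (ℤ)
import Data.Integer.Properties as ℤₚ
open import Data.Integer.Tactic.RingSolver using (solve-∀)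
open import Data.List using ([]; _∷_; allFin)
open import Data.List.Properties using (map-cong; map-tabulate)
open import Data.List.Relation.Unary.All as All using (All; []; _∷_)
open import Data.Nat using (zero; suc; pred; _+_; _*_; _∸_; _≤_; _<_; z≤n; s≤s; _<?_; >-nonZero)
import Data.Nat.Properties as ℕₚ
open import Data.Nat.ListAction using () renaming (sum to sumℕ)
import Data.Nat.Coprimality as Coprimality
open import Data.Product using (_,_; proj₁; proj₂)
import Data.Rational as ℚ
open import Data.Rational.Base using (*≤*)
import Data.Rational.Properties as ℚₚ
open import Data.Sum using (_⊎_; inj₁; inj₂)
open import Data.Unit using (tt)
open import Data.Vec using (Vec; lookup; updateAt; zipWith; map)
import Data.Vec.Properties as Vecₚ
import Data.Vec.Functional as Functional
open import Data.Vec.Functional using () renaming (_∷_ to _◂_)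
import Data.Vec.Functional.Properties as Functionalₚ
open import Function using (_∘_; id)
open import Function.Bundles using (_⇔_; mk⇔; Equivalence)
import Function.Properties.Equivalence as ⇔
open import Relation.Binary.Construct.Closure.ReflexiveTransitive using (Star; ε; _◅_; _◅◅_; gmap; fold)
open import Relation.Binary.PropositionalEquality
  using (refl; sym; trans; cong; cong₂; subst; subst₂; _≢_; _≗_; module ≡-Reasoning)
open import Relation.Nullary using (Dec; ¬_; yes; no; contradiction)
open import Relation.Nullary.Decidable using (⌊_⌋; _×-dec_; decidable-stable)

open CommutativeSemigroupProperties ℕₚ.+-commutativeSemigroup using (xy∙z≈xz∙y)
open ≡-Reasoning

x-y≡z-w⇔x+w≡z+y : ∀ (x y z w : ℤ) → (x ℤ.- y ≡ z ℤ.- w) ⇔ (x ℤ.+ w ≡ z ℤ.+ y)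
x-y≡z-w⇔x+w≡z+y x y z w = mk⇔
  (λ eq → begin
    x ℤ.+ w                      ≡⟨ expand x y w ⟩
    (x ℤ.- y) ℤ.+ (y ℤ.+ w)      ≡⟨ cong (ℤ._+ (y ℤ.+ w)) eq ⟩
    (z ℤ.- w) ℤ.+ (y ℤ.+ w)      ≡⟨ contract z y w ⟩
    z ℤ.+ y                      ∎)
  (λ eq → begin
    x ℤ.- y                      ≡⟨ shift x w y ⟩
    (x ℤ.+ w) ℤ.- (y ℤ.+ w)      ≡⟨ cong (ℤ._- (y ℤ.+ w)) eq ⟩
    (z ℤ.+ y) ℤ.- (y ℤ.+ w)      ≡⟨ cancel z y w ⟩
    z ℤ.- w                      ∎)
  where
  expand : ∀ (a b c : ℤ) → a ℤ.+ c ≡ (a ℤ.- b) ℤ.+ (b ℤ.+ c)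
  expand = solve-∀
  contract : ∀ (a b c : ℤ) → (a ℤ.- c) ℤ.+ (b ℤ.+ c) ≡ a ℤ.+ b
  contract = solve-∀
  shift : ∀ (a c b : ℤ) → a ℤ.- b ≡ (a ℤ.+ c) ℤ.- (b ℤ.+ c)
  shift = solve-∀
  cancel : ∀ (a b c : ℤ) → (a ℤ.+ b) ℤ.- (b ℤ.+ c) ≡ a ℤ.- c
  cancel = solve-∀

+a-+b≡+c-+d⇔a+d≡c+b : ∀ a b c d → (ℤ.+ a ℤ.- ℤ.+ b ≡ ℤ.+ c ℤ.- ℤ.+ d) ⇔ (a + d ≡ c + b)
+a-+b≡+c-+d⇔a+d≡c+b a b c d = mk⇔
  (λ eq → ℤₚ.+-injective (begin
    ℤ.+ (a + d)       ≡⟨ ℤₚ.pos-+ a d ⟩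
    ℤ.+ a ℤ.+ ℤ.+ d     ≡⟨ Equivalence.to (x-y≡z-w⇔x+w≡z+y (ℤ.+ a) (ℤ.+ b) (ℤ.+ c) (ℤ.+ d)) eq ⟩
    ℤ.+ c ℤ.+ ℤ.+ b     ≡⟨ ℤₚ.pos-+ c b ⟨
    ℤ.+ (c + b)       ∎))
  (λ eq → Equivalence.from (x-y≡z-w⇔x+w≡z+y (ℤ.+ a) (ℤ.+ b) (ℤ.+ c) (ℤ.+ d)) (begin
    ℤ.+ a ℤ.+ ℤ.+ d     ≡⟨ ℤₚ.pos-+ a d ⟨
    ℤ.+ (a + d)       ≡⟨ cong ℤ.+_ eq ⟩
    ℤ.+ (c + b)       ≡⟨ ℤₚ.pos-+ c b ⟩
    ℤ.+ c ℤ.+ ℤ.+ b     ∎))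

+a≡+c-+d⇔d+a≡c : ∀ a c d → (ℤ.+ a ≡ ℤ.+ c ℤ.- ℤ.+ d) ⇔ (d + a ≡ c)
+a≡+c-+d⇔d+a≡c a c d = mk⇔
  (λ eq → trans (ℕₚ.+-comm d a)
            (trans (Equivalence.to a-0⇔ (trans (ℤₚ.+-identityʳ (ℤ.+ a)) eq)) (ℕₚ.+-identityʳ c)))
  (λ eq → trans (sym (ℤₚ.+-identityʳ (ℤ.+ a)))
            (Equivalence.from a-0⇔ (trans (ℕₚ.+-comm a d) (trans eq (sym (ℕₚ.+-identityʳ c))))))
  where a-0⇔ = +a-+b≡+c-+d⇔a+d≡c+b a 0 c d

if-suc : ∀ b n → (if b then suc n else 0) ≡ (if b then n else 0) + (if b then 1 else 0)
if-suc true  n = ℕₚ.+-comm 1 n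
if-suc false n = refl

if-then-0 : ∀ b {n} → n ≡ 0 → (if b then n else 0) ≡ 0
if-then-0 true  n≡0 = n≡0
if-then-0 false _   = refl

⌊⌋-true : ∀ {P : Set} (P? : Dec P) → P → ⌊ P? ⌋ ≡ true
⌊⌋-true (yes _) _  = refl
⌊⌋-true (no ¬p) p  = contradiction p ¬p

⌊⌋-false : ∀ {P : Set} (P? : Dec P) → ¬ P → ⌊ P? ⌋ ≡ false
⌊⌋-false (yes p) ¬p = contradiction p ¬p
⌊⌋-false (no _)  _  = refl

toℚ≡mkℚ : ∀ k → toℚ k ≡ ℚ.mkℚ (ℤ.+ k) 0 (Coprimality.sym (Coprimality.1-coprimeTo k))
toℚ≡mkℚ k = ℚₚ.normalize-coprime _

toℚ-mono-≤ : ∀ {m n} → m ≤ n → toℚ m ℚ.≤ toℚ n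
toℚ-mono-≤ {m} {n} m≤n rewrite toℚ≡mkℚ m | toℚ≡mkℚ n =
  *≤* (subst₂ ℤ._≤_ (sym (ℤₚ.*-identityʳ (ℤ.+ m))) (sym (ℤₚ.*-identityʳ (ℤ.+ n))) (ℤ.+≤+ m≤n))

ΣFin-suc : ∀ {n} (f : Fin (suc n) → ℕ) → ΣFin f ≡ f zero + ΣFin (f ∘ suc)
ΣFin-suc f = cong (f zero +_) (cong sumℕ (trans (map-tabulate suc f) (sym (map-tabulate id (f ∘ suc)))))

ΣFin-cong : ∀ {n} {f f' : Fin n → ℕ} → f ≗ f' → ΣFin f ≡ ΣFin f'
ΣFin-cong f≗f' = cong sumℕ (map-cong f≗f' (allFin _))

ΣFin-zero : ∀ {n} {f : Fin n → ℕ} → (∀ i → f i ≡ 0) → ΣFin f ≡ 0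
ΣFin-zero {zero}      f≡0 = refl
ΣFin-zero {suc n} {f} f≡0 = trans (ΣFin-suc f) (cong₂ _+_ (f≡0 zero) (ΣFin-zero (f≡0 ∘ suc)))

ΣFin≡0⇒≡0 : ∀ {n} {f : Fin n → ℕ} → ΣFin f ≡ 0 → ∀ i → f i ≡ 0
ΣFin≡0⇒≡0 {suc n} {f} Σf≡0 zero    = ℕₚ.m+n≡0⇒m≡0 (f zero) (trans (sym (ΣFin-suc f)) Σf≡0)
ΣFin≡0⇒≡0 {suc n} {f} Σf≡0 (suc i) = ΣFin≡0⇒≡0 (ℕₚ.m+n≡0⇒n≡0 (f zero) (trans (sym (ΣFin-suc f)) Σf≡0)) i

ΣFin-positive : ∀ {n m} (f : Fin n → ℕ) → ΣFin f ≡ suc m → ∃[ i ] 0 < f i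
ΣFin-positive f Σf≡1+m with any? (λ i → 0 <? f i)
... | yes positive = positive
... | no ¬positive =
  contradiction (trans (sym Σf≡1+m) (ΣFin-zero (λ i → ℕₚ.n≤0⇒n≡0 (ℕₚ.≮⇒≥ (¬positive ∘ (i ,_)))))) λ ()

ΣFin-update : ∀ {n} {f f' : Fin n → ℕ} (i : Fin n) {c} →
  (∀ j → i ≢ j → f j ≡ f' j) → f i ≡ f' i + c → ΣFin f ≡ ΣFin f' + c
ΣFin-update {suc n} {f} {f'} zero {c} same fi = begin
  ΣFin f                              ≡⟨ ΣFin-suc f ⟩
  f zero + ΣFin (f ∘ suc)             ≡⟨ cong₂ _+_ fi (ΣFin-cong (λ j → same (suc j) λ ())) ⟩
  f' zero + c + ΣFin (f' ∘ suc)       ≡⟨ xy∙z≈xz∙y (f' zero) c _ ⟩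
  f' zero + ΣFin (f' ∘ suc) + c       ≡⟨ cong (_+ c) (ΣFin-suc f') ⟨
  ΣFin f' + c                         ∎
ΣFin-update {suc n} {f} {f'} (suc i) {c} same fi = begin
  ΣFin f                              ≡⟨ ΣFin-suc f ⟩
  f zero + ΣFin (f ∘ suc)             ≡⟨ cong₂ _+_ (same zero λ ())
                                                   (ΣFin-update i (λ j i≢j → same (suc j) (i≢j ∘ suc-injective)) fi) ⟩
  f' zero + (ΣFin (f' ∘ suc) + c)     ≡⟨ ℕₚ.+-assoc (f' zero) _ c ⟨
  f' zero + ΣFin (f' ∘ suc) + c       ≡⟨ cong (_+ c) (ΣFin-suc f') ⟨
  ΣFin f' + c                         ∎

IncrementAt : ∀ {n} → Fin n → (Fin n → ℕ) → (Fin n → ℕ) → Set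
IncrementAt i y' y = (∀ j → i ≢ j → y j ≡ y' j) × y i ≡ suc (y' i)

decrementAt : ∀ {n} → Fin n → (Fin n → ℕ) → Fin n → ℕ
decrementAt i y = Functional.updateAt y i pred

module _ {n} {i : Fin n} {y' y : Fin n → ℕ} (inc : IncrementAt i y' y) where

  ΣFin-increment : (F : Fin n → ℕ → ℕ) (c : Fin n → ℕ) → (∀ j m → F j (suc m) ≡ F j m + c j) →
                   ΣFin (λ j → F j (y j)) ≡ ΣFin (λ j → F j (y' j)) + c i
  ΣFin-increment F c F-suc =
    ΣFin-update i (λ j i≢j → cong (F j) (proj₁ inc j i≢j)) (trans (cong (F i) (proj₂ inc)) (F-suc i _))

  increment-at-positive : 0 < y i
  increment-at-positive = subst (0 <_) (sym (proj₂ inc)) (s≤s z≤n)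

  increment-positive : ∀ {j} → 0 < y' j → 0 < y j
  increment-positive {j} y'j>0 with i ≟ᶠ j
  ... | yes refl = increment-at-positive
  ... | no i≢j   = subst (0 <_) (sym (proj₁ inc j i≢j)) y'j>0

  increment-cong : ∀ {z' z} → IncrementAt i z' z → y' ≗ z' → y ≗ z
  increment-cong (same , zi) y'≗z' j with i ≟ᶠ j
  ... | yes refl = trans (proj₂ inc) (trans (cong suc (y'≗z' i)) (sym zi))
  ... | no i≢j   = trans (proj₁ inc j i≢j) (trans (y'≗z' j) (sym (same j i≢j)))

increment-decrementAt : ∀ {n} {i : Fin n} {y} → 0 < y i → IncrementAt i (decrementAt i y) y
increment-decrementAt {i = i} {y} yi>0 =
  (λ j i≢j → sym (Functionalₚ.updateAt-minimal j i y (i≢j ∘ sym))) ,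
  trans (sym (ℕₚ.suc-pred (y i) {{>-nonZero yi>0}})) (cong suc (sym (Functionalₚ.updateAt-updates i y)))

ΣFin-decrementAt : ∀ {n} {i : Fin n} {y} → 0 < y i → suc (ΣFin (decrementAt i y)) ≡ ΣFin y
ΣFin-decrementAt {i = i} {y} yi>0 =
  sym (trans (ΣFin-increment (increment-decrementAt {i = i} {y} yi>0) (λ _ m → m) (λ _ → 1)
                             (λ _ m → ℕₚ.+-comm 1 m))
             (ℕₚ.+-comm _ 1))

δ : ∀ {n} → Fin n → Fin n → ℕ
δ i j = if ⌊ i ≟ᶠ j ⌋ then 1 else 0

δ-refl : ∀ {n} (i : Fin n) → δ i i ≡ 1
δ-refl i = cong (if_then 1 else 0) (⌊⌋-true (i ≟ᶠ i) refl)

δ-≢ : ∀ {n} {i j : Fin n} → i ≢ j → δ i j ≡ 0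
δ-≢ {i = i} {j} i≢j = cong (if_then 1 else 0) (⌊⌋-false (i ≟ᶠ j) i≢j)

move : ∀ {n} → Fin n → Fin n → Vec ℕ n → Vec ℕ n
move a b k = updateAt (updateAt k a (λ m → m ∸ 1)) b suc

lookup-updateAt-suc : ∀ {n} (k : Vec ℕ n) b v → lookup (updateAt k b suc) v ≡ lookup k v + δ b v
lookup-updateAt-suc k b v with b ≟ᶠ v
... | yes refl = trans (Vecₚ.lookup∘updateAt b k) (ℕₚ.+-comm 1 (lookup k b))
... | no b≢v   = trans (Vecₚ.lookup∘updateAt′ v b (b≢v ∘ sym) k) (sym (ℕₚ.+-identityʳ _))

lookup-updateAt-∸1 : ∀ {n} (k : Vec ℕ n) a v → 0 < lookup k a →
                     lookup (updateAt k a (λ m → m ∸ 1)) v + δ a v ≡ lookup k v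
lookup-updateAt-∸1 k a v ka>0 with a ≟ᶠ v
... | yes refl = trans (cong (_+ 1) (Vecₚ.lookup∘updateAt a k)) (ℕₚ.m∸n+n≡m ka>0)
... | no a≢v   = trans (ℕₚ.+-identityʳ _) (Vecₚ.lookup∘updateAt′ v a (a≢v ∘ sym) k)

module _ {n} (a b : Fin n) (k : Vec ℕ n) where

  lookup-move : 0 < lookup k a → ∀ v → lookup (move a b k) v + δ a v ≡ lookup k v + δ b v
  lookup-move ka>0 v = begin
    lookup (move a b k) v + δ a v    ≡⟨ cong (_+ δ a v) (lookup-updateAt-suc k₋ b v) ⟩
    lookup k₋ v + δ b v + δ a v       ≡⟨ xy∙z≈xz∙y _ (δ b v) (δ a v) ⟩
    lookup k₋ v + δ a v + δ b v       ≡⟨ cong (_+ δ b v) (lookup-updateAt-∸1 k a v ka>0) ⟩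
    lookup k v + δ b v               ∎
    where k₋ = updateAt k a (λ m → m ∸ 1)

  move-≥ : 0 < lookup k a → ∀ {v} → a ≢ v → lookup k v ≤ lookup (move a b k) v
  move-≥ ka>0 {v} a≢v = subst (lookup k v ≤_)
    (trans (sym (lookup-move ka>0 v)) (trans (cong (lookup (move a b k) v +_) (δ-≢ a≢v)) (ℕₚ.+-identityʳ _)))
    (ℕₚ.m≤m+n _ _)

  move-≤ : 0 < lookup k a → ∀ {v} → b ≢ v → lookup (move a b k) v ≤ lookup k v
  move-≤ ka>0 {v} b≢v = subst (lookup (move a b k) v ≤_)
    (trans (lookup-move ka>0 v) (trans (cong (lookup k v +_) (δ-≢ b≢v)) (ℕₚ.+-identityʳ _)))
    (ℕₚ.m≤m+n _ _)

  move-keeps-source : 1 < lookup k a → 0 < lookup (move a b k) a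
  move-keeps-source ka>1 = ℕₚ.+-cancelʳ-≤ 1 1 _
    (ℕₚ.≤-trans ka>1 (ℕₚ.≤-trans (ℕₚ.m≤m+n _ (δ b a))
      (ℕₚ.≤-reflexive (trans (sym (lookup-move (ℕₚ.<⇒≤ ka>1) a))
                             (cong (lookup (move a b k) a +_) (δ-refl a))))))

  move-target : 0 < lookup (move a b k) b
  move-target = subst (0 <_) (sym (Vecₚ.lookup∘updateAt b (updateAt k a (λ m → m ∸ 1)))) (s≤s z≤n)

lookup⇒≡ : ∀ {n} {xs ys : Vec ℕ n} → (∀ i → lookup xs i ≡ lookup ys i) → xs ≡ ys
lookup⇒≡ {xs = xs} {ys} xs≗ys =
  trans (sym (Vecₚ.tabulate∘lookup xs)) (trans (Vecₚ.tabulate-cong xs≗ys) (Vecₚ.tabulate∘lookup ys))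

Star-preserves : ∀ {I : Set} {T : I → I → Set} (P : I → Set) →
                 (∀ {i j} → T i j → P i → P j) → ∀ {i j} → Star T i j → P i → P j
Star-preserves P step = fold (λ i j → P i → P j) (λ t continue → continue ∘ step t) id

module _ (A : TA) where
  open TA A
  open Rule using (from; to; φ)

  src tgt : Fin nR → Fin nL
  src r = from (rules r)
  tgt r = to (rules r)

  fire : Fin nR → Vec ℕ nL → Vec ℕ nL
  fire r = move (src r) (tgt r)

  raise : Fin nR → Vec ℕ nΓ → Vec ℕ nΓ
  raise r gv = zipWith _+_ gv (map b2n (Rule.u (rules r)))

  lookup-raise : ∀ r gv z → lookup (raise r gv) z ≡ lookup gv z + b2n (lookup (Rule.u (rules r)) z)
  lookup-raise r gv z =
    trans (Vecₚ.lookup-zipWith _+_ z gv _) (cong (lookup gv z +_) (Vecₚ.lookup-map z b2n (Rule.u (rules r))))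

  -- Flow equations

  inflow outflow : (Fin nR → ℕ) → Fin nL → ℕ
  inflow  x ℓ = ΣFin (λ r → if ⌊ tgt r ≟ᶠ ℓ ⌋ then x r else 0)
  outflow x ℓ = ΣFin (λ r → if ⌊ src r ≟ᶠ ℓ ⌋ then x r else 0)

  growth : (Fin nR → ℕ) → Fin nΓ → ℕ
  growth x z = ΣFin (λ r → x r * b2n (lookup (Rule.u (rules r)) z))

  Flow : Vec ℕ nL → Vec ℕ nL → (Fin nR → ℕ) → Set
  Flow k k' x = ∀ ℓ → inflow x ℓ + lookup k ℓ ≡ lookup k' ℓ + outflow x ℓ

  Shared : Vec ℕ nΓ → Vec ℕ nΓ → (Fin nR → ℕ) → Set
  Shared gv gv' x = ∀ z → lookup gv z + growth x z ≡ lookup gv' z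

  module _ {x : Fin nR → ℕ} (x≡0 : ∀ r → x r ≡ 0) where

    inflow-zero : ∀ ℓ → inflow x ℓ ≡ 0
    inflow-zero ℓ = ΣFin-zero (λ r → if-then-0 ⌊ tgt r ≟ᶠ ℓ ⌋ (x≡0 r))

    outflow-zero : ∀ ℓ → outflow x ℓ ≡ 0
    outflow-zero ℓ = ΣFin-zero (λ r → if-then-0 ⌊ src r ≟ᶠ ℓ ⌋ (x≡0 r))

    growth-zero : ∀ z → growth x z ≡ 0
    growth-zero z = ΣFin-zero (λ r → cong (_* b2n (lookup (Rule.u (rules r)) z)) (x≡0 r))

    flow-zero : ∀ {k k'} → Flow k k' x → k ≡ k'
    flow-zero {k} {k'} flow = lookup⇒≡ λ ℓ → begin
      lookup k ℓ                    ≡⟨ cong (_+ lookup k ℓ) (inflow-zero ℓ) ⟨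
      inflow x ℓ + lookup k ℓ       ≡⟨ flow ℓ ⟩
      lookup k' ℓ + outflow x ℓ     ≡⟨ cong (lookup k' ℓ +_) (outflow-zero ℓ) ⟩
      lookup k' ℓ + 0               ≡⟨ ℕₚ.+-identityʳ _ ⟩
      lookup k' ℓ                   ∎

    shared-zero : ∀ {gv gv'} → Shared gv gv' x → gv ≡ gv'
    shared-zero {gv} shared = lookup⇒≡ λ z →
      trans (sym (trans (cong (lookup gv z +_) (growth-zero z)) (ℕₚ.+-identityʳ _))) (shared z)

  module _ {r : Fin nR} {x' x : Fin nR → ℕ} (inc : IncrementAt r x' x) where

    inflow-increment : ∀ ℓ → inflow x ℓ ≡ inflow x' ℓ + δ (tgt r) ℓ
    inflow-increment ℓ = ΣFin-increment inc (λ q m → if ⌊ tgt q ≟ᶠ ℓ ⌋ then m else 0) (λ q → δ (tgt q) ℓ)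
                                            (λ q → if-suc ⌊ tgt q ≟ᶠ ℓ ⌋)

    outflow-increment : ∀ ℓ → outflow x ℓ ≡ outflow x' ℓ + δ (src r) ℓ
    outflow-increment ℓ = ΣFin-increment inc (λ q m → if ⌊ src q ≟ᶠ ℓ ⌋ then m else 0) (λ q → δ (src q) ℓ)
                                             (λ q → if-suc ⌊ src q ≟ᶠ ℓ ⌋)

    growth-increment : ∀ z → growth x z ≡ growth x' z + b2n (lookup (Rule.u (rules r)) z)
    growth-increment z = ΣFin-increment inc (λ q m → m * b2n (lookup (Rule.u (rules q)) z))
                                            (λ q → b2n (lookup (Rule.u (rules q)) z))
                                            (λ q m → ℕₚ.+-comm (b2n (lookup (Rule.u (rules q)) z)) _)

    module _ {k k' : Vec ℕ nL} (kr>0 : 0 < lookup k (src r)) where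

      inflow-shift : ∀ ℓ → inflow x ℓ + lookup k ℓ ≡ inflow x' ℓ + lookup (fire r k) ℓ + δ (src r) ℓ
      inflow-shift ℓ = begin
        inflow x ℓ + lookup k ℓ                           ≡⟨ cong (_+ lookup k ℓ) (inflow-increment ℓ) ⟩
        inflow x' ℓ + δ (tgt r) ℓ + lookup k ℓ            ≡⟨ ℕₚ.+-assoc (inflow x' ℓ) _ _ ⟩
        inflow x' ℓ + (δ (tgt r) ℓ + lookup k ℓ)          ≡⟨ cong (inflow x' ℓ +_) (ℕₚ.+-comm (δ (tgt r) ℓ) _) ⟩
        inflow x' ℓ + (lookup k ℓ + δ (tgt r) ℓ)          ≡⟨ cong (inflow x' ℓ +_) (lookup-move (src r) (tgt r) k kr>0 ℓ) ⟨
        inflow x' ℓ + (lookup (fire r k) ℓ + δ (src r) ℓ) ≡⟨ ℕₚ.+-assoc (inflow x' ℓ) _ _ ⟨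
        inflow x' ℓ + lookup (fire r k) ℓ + δ (src r) ℓ   ∎

      outflow-shift : ∀ ℓ → lookup k' ℓ + outflow x ℓ ≡ lookup k' ℓ + outflow x' ℓ + δ (src r) ℓ
      outflow-shift ℓ = trans (cong (lookup k' ℓ +_) (outflow-increment ℓ)) (sym (ℕₚ.+-assoc (lookup k' ℓ) _ _))

      flow-before : Flow (fire r k) k' x' → Flow k k' x
      flow-before flow ℓ = trans (inflow-shift ℓ) (trans (cong (_+ δ (src r) ℓ) (flow ℓ)) (sym (outflow-shift ℓ)))

      flow-after : Flow k k' x → Flow (fire r k) k' x'
      flow-after flow ℓ = ℕₚ.+-cancelʳ-≡ (δ (src r) ℓ) _ _
        (trans (sym (inflow-shift ℓ)) (trans (flow ℓ) (outflow-shift ℓ)))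

    shared-shift : ∀ gv z → lookup gv z + growth x z ≡ lookup (raise r gv) z + growth x' z
    shared-shift gv z = begin
      lookup gv z + growth x z                      ≡⟨ cong (lookup gv z +_) (growth-increment z) ⟩
      lookup gv z + (growth x' z + b)               ≡⟨ cong (lookup gv z +_) (ℕₚ.+-comm (growth x' z) b) ⟩
      lookup gv z + (b + growth x' z)               ≡⟨ ℕₚ.+-assoc (lookup gv z) b _ ⟨
      lookup gv z + b + growth x' z                 ≡⟨ cong (_+ growth x' z) (lookup-raise r gv z) ⟨
      lookup (raise r gv) z + growth x' z           ∎
      where b = b2n (lookup (Rule.u (rules r)) z)

  Step : (Fin nR → Set) → Fin nL → Fin nL → Set
  Step P ℓ ℓ' = ∃[ r ] (P r × src r ≡ ℓ × tgt r ≡ ℓ')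

  Step-mono : ∀ {P Q : Fin nR → Set} → (∀ {r} → P r → Q r) → ∀ {ℓ ℓ'} → Star (Step P) ℓ ℓ' → Star (Step Q) ℓ ℓ'
  Step-mono P⇒Q = gmap id (λ (r , pr , sr , tr) → r , P⇒Q pr , sr , tr)

  Positive : (Fin nR → ℕ) → Fin nR → Set
  Positive x r = 0 < x r

  Reach : (Fin nR → ℕ) → Vec ℕ nL → Fin nL → Set
  Reach x k ℓ = ∃[ ℓ₀ ] (0 < lookup k ℓ₀ × Star (Step (Positive x)) ℓ₀ ℓ)

  reach-extend : ∀ {x k ℓ ℓ'} → Reach x k ℓ → Step (Positive x) ℓ ℓ' → Reach x k ℓ'
  reach-extend (ℓ₀ , kℓ₀>0 , path) edge = ℓ₀ , kℓ₀>0 , path ◅◅ edge ◅ ε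

  SourcesReachable : (Fin nR → ℕ) → Vec ℕ nL → Set
  SourcesReachable x k = ∀ r → 0 < x r → Reach x k (src r)

  -- Chain x (κ σ) r is the witness that CondAppl σ x demands for r.
  Chain : (Fin nR → ℕ) → Vec ℕ nL → Fin nR → Set
  Chain x k r = ∃[ s ] Σ (Fin (suc s) → Fin nR) λ rs →
      (∀ i → 0 < x (rs i))
    × (0 < lookup k (src (rs zero)))
    × (∀ (i : Fin s) → tgt (rs (inject₁ i)) ≡ src (rs (suc i)))
    × (rs (fromℕ s) ≡ r)

  linked⇒path : ∀ {x} s (rs : Fin (suc s) → Fin nR) → (∀ i → 0 < x (rs i)) →
                (∀ (i : Fin s) → tgt (rs (inject₁ i)) ≡ src (rs (suc i))) →
                Star (Step (Positive x)) (src (rs zero)) (src (rs (fromℕ s)))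
  linked⇒path zero    rs _   _      = ε
  linked⇒path (suc s) rs pos linked =
    (rs zero , pos zero , refl , linked zero) ◅ linked⇒path s (rs ∘ suc) (pos ∘ suc) (linked ∘ suc)

  path⇒linked : ∀ {x ℓ r} → Star (Step (Positive x)) ℓ (src r) → 0 < x r →
    ∃[ s ] Σ (Fin (suc s) → Fin nR) λ rs →
        (∀ i → 0 < x (rs i))
      × (src (rs zero) ≡ ℓ)
      × (∀ (i : Fin s) → tgt (rs (inject₁ i)) ≡ src (rs (suc i)))
      × (rs (fromℕ s) ≡ r)
  path⇒linked {r = r} ε xr>0 = 0 , (λ _ → r) , (λ _ → xr>0) , refl , (λ ()) , refl
  path⇒linked ((e , xe>0 , refl , refl) ◅ path) xr>0 with path⇒linked path xr>0
  ... | s , rs , pos , start , linked , last =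
    suc s , e ◂ rs , (λ { zero → xe>0 ; (suc i) → pos i }) , refl ,
    (λ { zero → sym start ; (suc i) → linked i }) , last

  chain⇒reach : ∀ {x k r} → Chain x k r → Reach x k (src r)
  chain⇒reach (s , rs , pos , occupied , linked , last) =
    src (rs zero) , occupied , subst (Star _ _ ∘ src) last (linked⇒path s rs pos linked)

  reach⇒chain : ∀ {x k r} → Reach x k (src r) → 0 < x r → Chain x k r
  reach⇒chain {k = k} (ℓ₀ , kℓ₀>0 , path) xr>0 with path⇒linked path xr>0
  ... | s , rs , pos , start , linked , last =
    s , rs , pos , subst (λ ℓ → 0 < lookup k ℓ) (sym start) kℓ₀>0 , linked , last

  ReachableOrExhausted : (Fin nR → ℕ) → Vec ℕ nL → Fin nL → Set
  ReachableOrExhausted x k ℓ = Reach x k ℓ ⊎ (∀ e → src e ≡ ℓ → x e ≡ 0)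

  module _ {r : Fin nR} {x' x : Fin nR → ℕ} {k : Vec ℕ nL} (inc : IncrementAt r x' x) (kr>0 : 0 < lookup k (src r)) where

    reach-before : ∀ {ℓ} → Reach x' (fire r k) ℓ → Reach x k ℓ
    reach-before (ℓ₀ , mℓ₀>0 , path) with tgt r ≟ᶠ ℓ₀
    ... | yes refl = src r , kr>0 , (r , increment-at-positive inc , refl , refl) ◅ Step-mono (increment-positive inc) path
    ... | no tr≢ℓ₀ = ℓ₀ , ℕₚ.<-≤-trans mℓ₀>0 (move-≤ (src r) (tgt r) k kr>0 tr≢ℓ₀) , Step-mono (increment-positive inc) path

    reach-covered : ReachableOrExhausted x' (fire r k) (src r) → ∀ {e} → 0 < x' e → src e ≡ src r → Reach x' (fire r k) (src e)
    reach-covered (inj₁ R)         _     se≡sr = subst (Reach x' (fire r k)) (sym se≡sr) R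
    reach-covered (inj₂ exhausted) x'e>0 se≡sr = contradiction (exhausted _ se≡sr) (ℕₚ.n>0⇒n≢0 x'e>0)

    sources-after : ReachableOrExhausted x' (fire r k) (src r) → SourcesReachable x k → SourcesReachable x' (fire r k)
    sources-after covered reach e x'e>0 with reach e (increment-positive inc x'e>0)
    ... | ℓ₀ , kℓ₀>0 , path = reachable e x'e>0 (Star-preserves Good step path (start kℓ₀>0))
      where
      Good : Fin nL → Set
      Good ℓ = Reach x' (fire r k) ℓ ⊎ ℓ ≡ src r

      reachable : ∀ e → 0 < x' e → Good (src e) → Reach x' (fire r k) (src e)
      reachable e _ (inj₁ R) = R
      reachable e x'e>0 (inj₂ se≡sr) = reach-covered covered x'e>0 se≡sr

      start : ∀ {ℓ} → 0 < lookup k ℓ → Good ℓ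
      start {ℓ} kℓ>0 with ℓ ≟ᶠ src r
      ... | yes ℓ≡sr = inj₂ ℓ≡sr
      ... | no ℓ≢sr  = inj₁ (ℓ , ℕₚ.<-≤-trans kℓ>0 (move-≥ (src r) (tgt r) k kr>0 (ℓ≢sr ∘ sym)) , ε)

      step : ∀ {ℓ ℓ'} → Step (Positive x) ℓ ℓ' → Good ℓ → Good ℓ'
      step (e , xe>0 , refl , refl) good with r ≟ᶠ e
      ... | yes refl = inj₁ (tgt r , move-target (src r) (tgt r) k , ε)
      ... | no r≢e   = inj₁ (reach-extend {k = fire r k} (reachable e x'e>0′ good) (e , x'e>0′ , refl , refl))
        where x'e>0′ = subst (0 <_) (proj₁ inc e r≢e) xe>0

  -- Choosing the next rule

  Fireable : (Fin nR → ℕ) → Vec ℕ nL → Fin nR → Set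
  Fireable x k r = 0 < x r × 0 < lookup k (src r) × ReachableOrExhausted (decrementAt r x) (fire r k) (src r)

  Avoiding : (Fin nR → Set) → Fin nL → Fin nR → Set
  Avoiding P ℓ r = P r × src r ≢ ℓ

  last-exit : ∀ {P} ℓ {ℓ₁ ℓ₂} → Star (Step P) ℓ₁ ℓ₂ →
    Star (Step (Avoiding P ℓ)) ℓ₁ ℓ₂ ⊎ ∃[ r ] (P r × src r ≡ ℓ × Star (Step (Avoiding P ℓ)) (tgt r) ℓ₂)
  last-exit ℓ ε = inj₁ ε
  last-exit ℓ ((e , pe , refl , refl) ◅ path) with last-exit ℓ path
  ... | inj₂ exit = inj₂ exit
  ... | inj₁ avoiding with src e ≟ᶠ ℓ
  ...   | yes se≡ℓ = inj₂ (e , pe , se≡ℓ , avoiding)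
  ...   | no se≢ℓ  = inj₁ ((e , (pe , se≢ℓ) , refl , refl) ◅ avoiding)

  avoiding-source : ∀ {P ℓ ℓ₁ ℓ₂} → Star (Step (Avoiding P ℓ)) ℓ₁ ℓ₂ → ℓ₂ ≢ ℓ → ℓ₁ ≢ ℓ
  avoiding-source ε                                   ℓ₂≢ℓ = ℓ₂≢ℓ
  avoiding-source ((_ , (_ , se≢ℓ) , refl , _) ◅ _) _    = se≢ℓ

  occupied-source : ∀ {x k r} → SourcesReachable x k → 0 < x r → ∃[ e ] (0 < x e × 0 < lookup k (src e))
  occupied-source {r = r} reach xr>0 with reach r xr>0
  ... | _ , kℓ₀>0 , ε                           = r , xr>0 , kℓ₀>0
  ... | _ , kℓ₀>0 , (e , xe>0 , refl , _) ◅ _ = e , xe>0 , kℓ₀>0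

  module _ {x : Fin nR → ℕ} {k : Vec ℕ nL} {r : Fin nR} (xr>0 : 0 < x r) where

    fireable-crowded : 1 < lookup k (src r) → Fireable x k r
    fireable-crowded kr>1 = xr>0 , ℕₚ.<⇒≤ kr>1 , inj₁ (src r , move-keeps-source (src r) (tgt r) k kr>1 , ε)

    fireable-loop : 0 < lookup k (src r) → tgt r ≡ src r → Fireable x k r
    fireable-loop kr>0 loop =
      xr>0 , kr>0 , inj₁ (src r , subst (λ ℓ → 0 < lookup (fire r k) ℓ) loop (move-target (src r) (tgt r) k) , ε)

    fireable-avoiding : ∀ {ℓ ℓ₀} → src r ≡ ℓ → 0 < lookup k ℓ → 0 < lookup (fire r k) ℓ₀ →
                        Star (Step (Avoiding (Positive x) ℓ)) ℓ₀ ℓ → Fireable x k r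
    fireable-avoiding refl kr>0 mℓ₀>0 path = xr>0 , kr>0 , inj₁ (_ , mℓ₀>0 , Step-mono kept path)
      where
      kept : ∀ {e} → Avoiding (Positive x) (src r) e → 0 < decrementAt r x e
      kept {e} (xe>0 , se≢sr) =
        subst (0 <_) (proj₁ (increment-decrementAt xr>0) e (λ r≡e → se≢sr (cong src (sym r≡e)))) xe>0

    fireable-drained : ∀ {k'} → Flow k k' x → lookup k (src r) ≡ 1 → (∀ q → 0 < x q → tgt q ≢ src r) →
                       Fireable x k r
    fireable-drained {k'} flow kr≡1 no-inflow = xr>0 , subst (0 <_) (sym kr≡1) (s≤s z≤n) , inj₂ exhausted
      where
      ℓ = src r
      x' = decrementAt r x

      no-inflow-term : ∀ q → (if ⌊ tgt q ≟ᶠ ℓ ⌋ then x q else 0) ≡ 0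
      no-inflow-term q with tgt q ≟ᶠ ℓ
      ... | yes tq≡ℓ = ℕₚ.n≤0⇒n≡0 (ℕₚ.≮⇒≥ λ xq>0 → no-inflow q xq>0 tq≡ℓ)
      ... | no _     = refl

      one≡ : 1 ≡ lookup k' ℓ + (outflow x' ℓ + 1)
      one≡ = begin
        1                                  ≡⟨ cong₂ _+_ (ΣFin-zero no-inflow-term) kr≡1 ⟨
        inflow x ℓ + lookup k ℓ            ≡⟨ flow ℓ ⟩
        lookup k' ℓ + outflow x ℓ          ≡⟨ cong (lookup k' ℓ +_) (outflow-increment (increment-decrementAt xr>0) ℓ) ⟩
        lookup k' ℓ + (outflow x' ℓ + δ ℓ ℓ) ≡⟨ cong (λ d → lookup k' ℓ + (outflow x' ℓ + d)) (δ-refl ℓ) ⟩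
        lookup k' ℓ + (outflow x' ℓ + 1)   ∎

      outflow≡0 : outflow x' ℓ ≡ 0
      outflow≡0 = ℕₚ.m+n≡0⇒n≡0 (lookup k' ℓ) (ℕₚ.suc-injective (sym (trans one≡
        (trans (cong (lookup k' ℓ +_) (ℕₚ.+-comm (outflow x' ℓ) 1)) (ℕₚ.+-suc (lookup k' ℓ) _)))))

      exhausted : ∀ e → src e ≡ ℓ → x' e ≡ 0
      exhausted e se≡ℓ =
        trans (sym (cong (λ b → if b then x' e else 0) (⌊⌋-true (src e ≟ᶠ ℓ) se≡ℓ))) (ΣFin≡0⇒≡0 outflow≡0 e)

  fireable-reentered : ∀ {x k e e₀} → SourcesReachable x k → 0 < x e → 0 < lookup k (src e) →
                       0 < x e₀ → tgt e₀ ≡ src e → ∃[ r ] Fireable x k r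
  fireable-reentered {x} {k} {e} {e₀} reach xe>0 ke>0 xe₀>0 te₀≡se with src e₀ ≟ᶠ src e
  ... | yes se₀≡se =
    e₀ , fireable-loop {k = k} xe₀>0 (subst (λ ℓ → 0 < lookup k ℓ) (sym se₀≡se) ke>0) (trans te₀≡se (sym se₀≡se))
  ... | no se₀≢se with reach e₀ xe₀>0
  ...   | ℓ₀ , kℓ₀>0 , path with last-exit (src e) path
  ...     | inj₁ avoiding =
    e , fireable-avoiding {k = k} xe>0 refl ke>0
          (ℕₚ.<-≤-trans kℓ₀>0 (move-≥ (src e) (tgt e) k ke>0 (avoiding-source avoiding se₀≢se ∘ sym)))
          (avoiding ◅◅ (e₀ , (xe₀>0 , se₀≢se) , refl , te₀≡se) ◅ ε)
  ...     | inj₂ (r , xr>0 , sr≡se , avoiding) =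
    r , fireable-avoiding {k = k} xr>0 sr≡se ke>0 (move-target (src r) (tgt r) k)
          (avoiding ◅◅ (e₀ , (xe₀>0 , se₀≢se) , refl , te₀≡se) ◅ ε)

  fireable-exists : ∀ {x k k'} → Flow k k' x → SourcesReachable x k → ∀ {r₀} → 0 < x r₀ → ∃[ r ] Fireable x k r
  fireable-exists {x} {k} {k'} flow reach xr₀>0 with occupied-source {k = k} reach xr₀>0
  ... | e , xe>0 , ke>0 with 1 <? lookup k (src e)
  ...   | yes ke>1 = e , fireable-crowded {k = k} xe>0 ke>1
  ...   | no ke≯1 with any? (λ q → (0 <? x q) ×-dec (tgt q ≟ᶠ src e))
  ...     | yes (e₀ , xe₀>0 , te₀≡se) = fireable-reentered {k = k} reach xe>0 ke>0 xe₀>0 te₀≡se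
  ...     | no no-inflow = e , fireable-drained {k = k} xe>0 {k'} flow (ℕₚ.≤-antisym (ℕₚ.≮⇒≥ ke≯1) ke>0)
                                 (λ q xq>0 tq≡se → no-inflow (q , xq>0 , tq≡se))

  InContext-mono : ∀ {σ σ'} → p σ ≡ p σ' → (∀ z → lookup (g σ) z ≤ lookup (g σ') z) →
                   ∀ gd → InContext A σ gd → InContext A σ' gd
  InContext-mono {σ} {σ'} p≡ g≤ gd@(guard rise x _ _) (G , holds) =
    G , subst (Holds gd (g σ')) p≡ (ℚₚ.≤-trans holds (toℚ-mono-≤ (g≤ x)))
  InContext-mono {σ} {σ'} p≡ g≤ gd@(guard fall x _ _) (G , ¬holds) =
    G , λ holds' → ¬holds (ℚₚ.≤-<-trans (toℚ-mono-≤ (g≤ x)) (subst (Holds gd (g σ')) (sym p≡) holds'))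

  sameContext-sym : ∀ {σ σ'} → SameContext A σ σ' → SameContext A σ' σ
  sameContext-sym ctx gd = ⇔.sym (ctx gd)

  sameContext-between : ∀ {σ₀ σ σ'} → SameContext A σ₀ σ' → p σ ≡ p σ₀ → p σ₀ ≡ p σ' →
                        (∀ z → lookup (g σ₀) z ≤ lookup (g σ) z) → (∀ z → lookup (g σ) z ≤ lookup (g σ') z) →
                        SameContext A σ σ₀
  sameContext-between ctx p≡ p≡' g₀≤g g≤g' gd = mk⇔
    (λ c → Equivalence.from (ctx gd) (InContext-mono (trans p≡ p≡') g≤g' gd c))
    (InContext-mono (sym p≡) g₀≤g gd)

  holds-transfer : ∀ {σ σ'} → SameContext A σ σ' → ∀ gd → GuardOfTA A gd →
                   Holds gd (g σ) (p σ) → Holds gd (g σ') (p σ')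
  holds-transfer ctx gd@(guard rise _ _ _) G holds = proj₂ (Equivalence.to (ctx gd) (G , holds))
  holds-transfer ctx gd@(guard fall _ _ _) G holds =
    decidable-stable (_ ℚₚ.<? _) λ ¬holds' → proj₂ (Equivalence.from (ctx gd) (G , ¬holds')) holds

  sat-transfer : ∀ {σ σ'} → SameContext A σ σ' → ∀ r → Sat A σ (φ (rules r)) → Sat A σ' (φ (rules r))
  sat-transfer ctx r sat = All.tabulate λ {gd} gd∈φ → holds-transfer ctx gd (r , gd∈φ) (All.lookup sat gd∈φ)

  -- From steady schedules to the formula

  occ-∷ : ∀ r τ → IncrementAt r (occ A τ) (occ A (r ∷ τ))
  occ-∷ r τ = others , here
    where
    others : ∀ q → r ≢ q → occ A (r ∷ τ) q ≡ occ A τ q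
    others q r≢q with r ≟ᶠ q
    ... | yes r≡q = contradiction r≡q r≢q
    ... | no _    = refl
    here : occ A (r ∷ τ) r ≡ suc (occ A τ r)
    here with r ≟ᶠ r
    ... | yes _   = refl
    ... | no r≢r  = contradiction refl r≢r

  p-run : ∀ σ τ → p (run A σ τ) ≡ p σ
  p-run σ []      = refl
  p-run σ (r ∷ τ) = p-run (apply A r σ) τ

  All-configs⇒run : ∀ {P : Config A → Set} σ τ → All P (configs A σ τ) → P (run A σ τ)
  All-configs⇒run σ []      (Pσ ∷ []) = Pσ
  All-configs⇒run σ (r ∷ τ) (_ ∷ Ps)  = All-configs⇒run (apply A r σ) τ Ps

  run-flow : ∀ σ τ → Applicable A σ τ → Flow (κ σ) (κ (run A σ τ)) (occ A τ)
  run-flow σ [] _ ℓ = begin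
    inflow (occ A []) ℓ + lookup (κ σ) ℓ   ≡⟨ cong (_+ lookup (κ σ) ℓ) (inflow-zero (λ _ → refl) ℓ) ⟩
    lookup (κ σ) ℓ                          ≡⟨ ℕₚ.+-identityʳ _ ⟨
    lookup (κ σ) ℓ + 0                      ≡⟨ cong (lookup (κ σ) ℓ +_) (outflow-zero (λ _ → refl) ℓ) ⟨
    lookup (κ σ) ℓ + outflow (occ A []) ℓ   ∎
  run-flow σ (r ∷ τ) (enabled , applicable) =
    flow-before (occ-∷ r τ) {κ σ} {κ (run A (apply A r σ) τ)} (proj₁ enabled)
                (run-flow (apply A r σ) τ applicable)

  run-shared : ∀ σ τ → Shared (g σ) (g (run A σ τ)) (occ A τ)
  run-shared σ []      z = trans (cong (lookup (g σ) z +_) (growth-zero (λ _ → refl) z)) (ℕₚ.+-identityʳ _)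
  run-shared σ (r ∷ τ) z = trans (shared-shift (occ-∷ r τ) (g σ) z) (run-shared (apply A r σ) τ z)

  run-guards : ∀ σ₀ σ τ → Applicable A σ τ → All (λ σᵢ → SameContext A σᵢ σ₀) (configs A σ τ) →
               CondR A σ₀ (occ A τ)
  run-guards σ₀ σ (r ∷ τ) (enabled , applicable) (ctx ∷ ctxs) q occ>0 with r ≟ᶠ q
  ... | yes refl = sat-transfer ctx r (proj₂ enabled)
  ... | no _     = run-guards σ₀ (apply A r σ) τ applicable ctxs q occ>0

  run-reach : ∀ σ τ → Applicable A σ τ → SourcesReachable (occ A τ) (κ σ)
  run-reach σ (r ∷ τ) (enabled , applicable) q occ>0 with r ≟ᶠ q
  ... | yes refl = src r , proj₁ enabled , ε
  ... | no _     =
    reach-before {k = κ σ} (occ-∷ r τ) (proj₁ enabled) (run-reach (apply A r σ) τ applicable q occ>0)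

  steady⇒phiSteady : ∀ {σ} τ → InRC A (p σ) → Applicable A σ τ → Steady A σ τ →
                     PhiSteadyWith A σ (run A σ τ) (occ A τ)
  steady⇒phiSteady {σ} τ rc applicable steady =
    (sym (p-run σ τ) , rc , cong (Nval A) (sym (p-run σ τ)) , sameContext-sym (All-configs⇒run σ τ steady)) ,
    (λ ℓ → Equivalence.from (+a-+b≡+c-+d⇔a+d≡c+b (inflow (occ A τ) ℓ) (outflow (occ A τ) ℓ) _ _)
                              (run-flow σ τ applicable ℓ)) ,
    (λ z → Equivalence.from (+a≡+c-+d⇔d+a≡c (growth (occ A τ) z) _ _) (run-shared σ τ z)) ,
    run-guards σ σ τ applicable steady ,
    (λ r occ>0 → reach⇒chain {k = κ σ} (run-reach σ τ applicable r occ>0) occ>0)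

  -- From the formula to steady schedules

  config-≡ : ∀ {σ σ' : Config A} → κ σ ≡ κ σ' → g σ ≡ g σ' → p σ ≡ p σ' → σ ≡ σ'
  config-≡ {σ} {σ'} κ≡ g≡ p≡ = trans (cong (λ k → config k (g σ) (p σ)) κ≡) (cong₂ (config (κ σ')) g≡ p≡)

  module Realisation {σ₀ σ' : Config A} {y₀ : Fin nR → ℕ}
                     (ctx : SameContext A σ₀ σ') (p≡ : p σ₀ ≡ p σ') (guards : CondR A σ₀ y₀) where

    record Invariant (σ : Config A) (y : Fin nR → ℕ) : Set where
      field
        same-params : p σ ≡ p σ₀
        grown       : ∀ z → lookup (g σ₀) z ≤ lookup (g σ) z
        flow        : Flow (κ σ) (κ σ') y
        shared      : Shared (g σ) (g σ') y
        sources     : SourcesReachable y (κ σ)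
        within      : ∀ {r} → 0 < y r → 0 < y₀ r

    initial : CondL A σ₀ σ' y₀ → CondΓ A σ₀ σ' y₀ → CondAppl A σ₀ y₀ → Invariant σ₀ y₀
    initial L Γ appl = record
      { same-params = refl
      ; grown       = λ _ → ℕₚ.≤-refl
      ; flow        = λ ℓ → Equivalence.to (+a-+b≡+c-+d⇔a+d≡c+b (inflow y₀ ℓ) (outflow y₀ ℓ) _ _) (L ℓ)
      ; shared      = λ z → Equivalence.to (+a≡+c-+d⇔d+a≡c (growth y₀ z) _ _) (Γ z)
      ; sources     = λ r y₀r>0 → chain⇒reach {k = κ σ₀} (appl r y₀r>0)
      ; within      = id
      }

    module _ {σ y} (I : Invariant σ y) where
      open Invariant I

      context : SameContext A σ σ₀
      context = sameContext-between ctx same-params p≡ grown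
        (λ z → subst (lookup (g σ) z ≤_) (shared z) (ℕₚ.m≤m+n _ _))

      enabled : ∀ {r} → Fireable y (κ σ) r → Enabled A r σ
      enabled {r} (yr>0 , kr>0 , _) = kr>0 , sat-transfer (sameContext-sym context) r (guards r (within yr>0))

      fired : ∀ {r} → Fireable y (κ σ) r → Invariant (apply A r σ) (decrementAt r y)
      fired {r} (yr>0 , kr>0 , covered) = record
        { same-params = same-params
        ; grown       = λ z → ℕₚ.≤-trans (grown z)
                                (subst (lookup (g σ) z ≤_) (sym (lookup-raise r (g σ) z)) (ℕₚ.m≤m+n _ _))
        ; flow        = flow-after inc {κ σ} {κ σ'} kr>0 flow
        ; shared      = λ z → trans (sym (shared-shift inc (g σ) z)) (shared z)
        ; sources     = sources-after {k = κ σ} inc kr>0 covered sources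
        ; within      = within ∘ increment-positive inc
        }
        where inc = increment-decrementAt {i = r} {y} yr>0

      final : (∀ r → y r ≡ 0) → σ ≡ σ'
      final y≡0 = config-≡ (flow-zero y≡0 flow) (shared-zero y≡0 shared) (trans same-params p≡)

    Schedule : Config A → (Fin nR → ℕ) → Set
    Schedule σ y = ∃[ τ ] (Applicable A σ τ × All (λ σᵢ → SameContext A σᵢ σ₀) (configs A σ τ)
                           × run A σ τ ≡ σ' × (∀ r → occ A τ r ≡ y r))

    schedule : ∀ n {σ y} → ΣFin y ≡ n → Invariant σ y → Schedule σ y
    schedule zero Σy≡0 I =
      [] , tt , context I ∷ [] , final I (ΣFin≡0⇒≡0 Σy≡0) , λ r → sym (ΣFin≡0⇒≡0 Σy≡0 r)
    schedule (suc n) {σ} {y} Σy≡1+n I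
      with r , fireable ← fireable-exists {k = κ σ} {κ σ'} (Invariant.flow I) (Invariant.sources I)
                                         (proj₂ (ΣFin-positive y Σy≡1+n))
      with τ , applicable , steady , end , count ←
             schedule n (ℕₚ.suc-injective (trans (ΣFin-decrementAt {i = r} {y} (proj₁ fireable)) Σy≡1+n))
                        (fired I fireable)
      = r ∷ τ , (enabled I fireable , applicable) , context I ∷ steady , end ,
        increment-cong (occ-∷ r τ) (increment-decrementAt (proj₁ fireable)) count

  phiSteady⇒steady : ∀ {σ σ' y} → PhiSteadyWith A σ σ' y →
    ∃[ τ ] (Applicable A σ τ × Steady A σ τ × run A σ τ ≡ σ' × (∀ r → occ A τ r ≡ y r))
  phiSteady⇒steady {y = y} ((p≡ , _ , _ , ctx) , L , Γ , guards , appl) = schedule (ΣFin y) refl (initial L Γ appl)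
    where open Realisation ctx p≡ guards

lemma4 : (A : TA) (σ σ' : Config A) → IsConfig A σ → IsConfig A σ' →
    ((τ : List (Fin (TA.nR A))) → Applicable A σ τ → Steady A σ τ → run A σ τ ≡ σ' →
        PhiSteadyWith A σ σ' (occ A τ))
    × ((y : Fin (TA.nR A) → ℕ) → PhiSteadyWith A σ σ' y →
        ∃[ τ ] (Applicable A σ τ × Steady A σ τ × run A σ τ ≡ σ'
                × (∀ r → occ A τ r ≡ y r)))
lemma4 A σ σ' (rc , _) _ =
  (λ τ applicable steady end →
    subst (λ σ″ → PhiSteadyWith A σ σ″ (occ A τ)) end (steady⇒phiSteady A τ rc applicable steady)) ,
  λ _ → phiSteady⇒steady A
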